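{- Let $V$ be a vertex set with $|V|=n\ge 2$ and let $G$ be the disjoint union of $n-1$ spanning arborescences $A_1,\dots,A_{n-1}$ on $V$. If $G$ has a rainbow arborescence $\tilde B$ with vertex set $\tilde V\subseteq V$ such that $\tilde V$ contains all multi-roots, then $G$ has a rainbow spanning arborescence.
   Context: An arborescence is a connected digraph in which exactly one vertex (the root) has no incoming arc and every other vertex has exactly one incoming arc (a single vertex with no arcs is an arborescence); it is spanning on $V$ if its vertex set is $V$. $G$ is the disjoint union of the arc sets $A_i$ (parallel arcs of different indices allowed). A subgraph $B$ of $G$ is rainbow if $|B\cap A_i|\le 1$ for all $i$. For $v\in V$, $\rho(v):=\{i\in[n-1] \mid \text{the root of } A_i \text{ is } v\}$; $v$ is a multi-root if $|\rho(v)|\ge 2$. -}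

module Defs where

open import Data.Nat using (ℕ; _≡ᵇ_; _≤_)
open import Data.Fin using (Fin; _≟_)
open import Data.Fin.Subset using (Subset; _∈_)
open import Data.List using (List; length; filter)
open import Data.List.Membership.Propositional renaming (_∈_ to _∈ₗ_)
open import Data.List.Relation.Unary.Unique.Propositional using (Unique)
open import Data.Product using (Σ; ∃; ∃-syntax; _×_; _,_; proj₁; proj₂)
open import Data.Sum using (_⊎_)
open import Relation.Binary.PropositionalEquality using (_≡_; _≢_)
open import Relation.Nullary using (¬_)

module _ {n : ℕ} {E : Set} (src tgt : E → Fin n) where

  indeg : List E → Fin n → ℕ
  indeg arcs v = length (filter (λ e → tgt e ≟ v) arcs)

  data Reach (arcs : List E) : Fin n → Fin n → Set where
    here : ∀ {u} → Reach arcs u u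
    fwd  : ∀ {u} (e : E) → e ∈ₗ arcs → Reach arcs u (src e) → Reach arcs u (tgt e)
    bwd  : ∀ {u} (e : E) → e ∈ₗ arcs → Reach arcs u (tgt e) → Reach arcs u (src e)

  IsDigraph : Subset n → List E → Set
  IsDigraph U arcs = Unique arcs × (∀ e → e ∈ₗ arcs → (src e ∈ U) × (tgt e ∈ U))

  Connected : Subset n → List E → Set
  Connected U arcs = ∀ u v → u ∈ U → v ∈ U → Reach arcs u v

  IsRoot : Subset n → List E → Fin n → Set
  IsRoot U arcs r = (r ∈ U) × (indeg arcs r ≡ 0)

  IsArborescence : Subset n → List E → Set
  IsArborescence U arcs =
    IsDigraph U arcs × Connected U arcs ×
    (∃[ r ] (IsRoot U arcs r ×
             (∀ v → v ∈ U → v ≢ r → indeg arcs v ≡ 1)))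

-- plain arcs of a single A_i : (tail , head)
Arc : ℕ → Set
Arc n = Fin n × Fin n

-- arcs of G = disjoint union of A_1..A_{n-1} : (index i , arc of A_i)
GArc : ℕ → Set
GArc n = Fin (Data.Nat._∸_ n 1) × Arc n

gsrc : ∀ {n} → GArc n → Fin n
gsrc e = proj₁ (proj₂ e)

gtgt : ∀ {n} → GArc n → Fin n
gtgt e = proj₂ (proj₂ e)

module _ {n : ℕ} (A : Fin (Data.Nat._∸_ n 1) → List (Arc n)) where

  InG : List (GArc n) → Set
  InG B = ∀ e → e ∈ₗ B → proj₂ e ∈ₗ A (proj₁ e)

  Rainbow : List (GArc n) → Set
  Rainbow B = ∀ i → length (filter (λ e → proj₁ e ≟ i) B) ≤ 1

  RainbowArborescence : Subset n → List (GArc n) → Set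
  RainbowArborescence U B =
    InG B × Rainbow B × IsArborescence gsrc gtgt U B

  MultiRoot : Subset n → Fin n → Set
  MultiRoot V v = ∃[ i ] ∃[ j ] (i ≢ j × IsRoot proj₁ proj₂ V (A i) v × IsRoot proj₁ proj₂ V (A j) v)

{-# OPTIONS --safe #-}
-- Grow B̃ one vertex at a time, keeping a rainbow arborescence that contains all multi-roots.
-- If an unused colour j is rooted inside the tree T, the path of A_j from its root to a
-- missing vertex x leaves T along an arc, which is added.  Otherwise the unused colours have
-- distinct roots (multi-roots lie in T) outside T, and as there are exactly n - |T| of them,
-- some unused colour i is rooted at x and every used colour is rooted inside T.  Re-root the
-- tree at the tail u of the arc of A_i entering its root: if u ∉ T this adds u; otherwise
-- it frees the colour of u's old in-arc, which is rooted inside T, and the first case applies.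
module Submission where

open import Defs
open import Data.Nat using (ℕ; zero; suc; _≤_; _∸_; _+_; z≤n; s≤s)
open import Data.Nat.Properties using (≤-antisym; ≤-reflexive; 1+n≰n)
open import Data.Fin using (Fin; punchOut; _≟_) renaming (zero to fzero)
import Data.Fin.Properties as Fin
open import Data.Fin.Subset using (Subset; _∈_; _∉_; _⊆_; _⊂_; _⊃_; ⊤; _∪_; ⁅_⁆)
open import Data.Fin.Subset.Properties
  using (_∈?_; ∈⊤; ⊆⊤; ⊆-antisym; x∈⁅x⁆; x∈⁅y⁆⇒x≡y; x∈p∪q⁻; p⊆p∪q; q⊆p∪q)
open import Data.Fin.Subset.Induction using (⊃-wellFounded)
open import Induction.WellFounded using (Acc; acc)
open import Data.List using (List; []; _∷_; length; filter)
open import Data.List.Properties using (filter-none)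
open import Data.List.Relation.Unary.Any as Any using (Any; here; there)
open import Data.List.Relation.Unary.All as All using (_∷_)
open import Data.List.Relation.Unary.AllPairs using (_∷_)
open import Data.List.Relation.Unary.Unique.Propositional using (Unique)
import Data.List.Relation.Unary.Unique.Propositional.Properties as Unique
open import Data.List.Membership.Propositional using (find; lose) renaming (_∈_ to _∈ₗ_)
open import Data.List.Membership.Propositional.Properties using (∈-filter⁺; ∈-filter⁻; ∈-length)
open import Data.List.Relation.Binary.Subset.Propositional using () renaming (_⊆_ to _⊆ₗ_)
open import Data.List.Relation.Binary.Subset.Propositional.Properties using (filter-⊆)
open import Data.Product using (∃; ∃₂; ∃-syntax; _×_; _,_; proj₁; proj₂)
import Data.Product as Product
open import Data.Sum using (inj₁; inj₂; [_,_])
open import Data.Empty using (⊥-elim)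
open import Function using (_∘_; id)
open import Function.Definitions using (Injective)
open import Relation.Nullary using (¬_; Dec; yes; no; ¬?)
open import Relation.Nullary.Decidable using (_×-dec_; decidable-stable)
open import Relation.Binary.PropositionalEquality using (_≡_; _≢_; refl; sym; trans; cong; subst)

p⊂p∪⁅x⁆ : ∀ {n} {p : Subset n} {x} → x ∉ p → p ⊂ p ∪ ⁅ x ⁆
p⊂p∪⁅x⁆ {p = p} {x} x∉p = p⊆p∪q ⁅ x ⁆ , x , q⊆p∪q p ⁅ x ⁆ (x∈⁅x⁆ x) , x∉p

x∈p⇒p∪⁅x⁆≡p : ∀ {n} {p : Subset n} {x} → x ∈ p → p ∪ ⁅ x ⁆ ≡ p
x∈p⇒p∪⁅x⁆≡p {p = p} {x} x∈p = ⊆-antisym ∪⁅x⁆⊆p (p⊆p∪q ⁅ x ⁆)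
  where
  ∪⁅x⁆⊆p : p ∪ ⁅ x ⁆ ⊆ p
  ∪⁅x⁆⊆p y∈ = [ id , (λ y∈⁅x⁆ → subst (_∈ p) (sym (x∈⁅y⁆⇒x≡y x y∈⁅x⁆)) x∈p) ] (x∈p∪q⁻ p ⁅ x ⁆ y∈)

injective-missing-two : ∀ {m n} {f : Fin m → Fin n} {a b : Fin n} → Injective _≡_ _≡_ f →
  a ≢ b → (∀ i → f i ≢ a) → (∀ i → f i ≢ b) → 2 + m ≤ n
injective-missing-two {n = suc zero} {a = fzero} {fzero} _ a≢b _ _ = ⊥-elim (a≢b refl)
injective-missing-two {n = suc (suc _)} {f} {a} {b} f-inj a≢b f≢a f≢b =
  s≤s (s≤s (Fin.injective⇒≤ g-inj))
  where
  a≢f : ∀ i → a ≢ f i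
  a≢f i = f≢a i ∘ sym
  b′≢f′ : ∀ i → punchOut a≢b ≢ punchOut (a≢f i)
  b′≢f′ i = f≢b i ∘ sym ∘ Fin.punchOut-injective a≢b (a≢f i)
  g-inj : Injective _≡_ _≡_ (λ i → punchOut (b′≢f′ i))
  g-inj = f-inj ∘ Fin.punchOut-injective (a≢f _) (a≢f _) ∘ Fin.punchOut-injective (b′≢f′ _) (b′≢f′ _)

module _ {X : Set} where

  length≤1⇒≡ : ∀ {xs : List X} {x y} → length xs ≤ 1 → x ∈ₗ xs → y ∈ₗ xs → x ≡ y
  length≤1⇒≡ {_ ∷ []} _ (here refl) (here refl) = refl
  length≤1⇒≡ {_ ∷ _ ∷ _} (s≤s ()) _ _

  unique⇒length≤1 : ∀ {xs : List X} → Unique xs → (∀ {x y} → x ∈ₗ xs → y ∈ₗ xs → x ≡ y) → length xs ≤ 1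
  unique⇒length≤1 {[]} _ _ = z≤n
  unique⇒length≤1 {_ ∷ []} _ _ = s≤s z≤n
  unique⇒length≤1 {_ ∷ _ ∷ _} ((x≢y ∷ _) ∷ _) all≡ = ⊥-elim (x≢y (all≡ (here refl) (there (here refl))))

  InjectiveOn : ∀ {Y : Set} → (X → Y) → List X → Set
  InjectiveOn f xs = ∀ {x y} → x ∈ₗ xs → y ∈ₗ xs → f x ≡ f y → x ≡ y

  module _ {Y : Set} {f : X → Y} where

    injectiveOn-∷ : ∀ {x xs} → InjectiveOn f xs → (∀ {y} → y ∈ₗ xs → f y ≢ f x) → InjectiveOn f (x ∷ xs)
    injectiveOn-∷ inj fresh (here refl) (here refl) _ = refl
    injectiveOn-∷ inj fresh (here refl) (there y∈) fx≡fy = ⊥-elim (fresh y∈ (sym fx≡fy))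
    injectiveOn-∷ inj fresh (there x∈) (here refl) fx≡fy = ⊥-elim (fresh x∈ fx≡fy)
    injectiveOn-∷ inj fresh (there x∈) (there y∈) fx≡fy = inj x∈ y∈ fx≡fy

    injectiveOn-⊆ : ∀ {xs ys} → ys ⊆ₗ xs → InjectiveOn f xs → InjectiveOn f ys
    injectiveOn-⊆ ys⊆xs inj x∈ y∈ = inj (ys⊆xs x∈) (ys⊆xs y∈)

    unique-∷ : ∀ {x xs} → Unique xs → (∀ {y} → y ∈ₗ xs → f y ≢ f x) → Unique (x ∷ xs)
    unique-∷ unique fresh = All.tabulate (λ y∈ x≡y → fresh y∈ (cong f (sym x≡y))) ∷ unique

  module _ {m : ℕ} (f : X → Fin m) where

    fibre : Fin m → List X → List X
    fibre y = filter (λ x → f x ≟ y)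

    ∈-fibre⁺ : ∀ {x xs y} → x ∈ₗ xs → f x ≡ y → x ∈ₗ fibre y xs
    ∈-fibre⁺ {y = y} = ∈-filter⁺ (λ x → f x ≟ y)

    ∈-fibre⁻ : ∀ {x xs y} → x ∈ₗ fibre y xs → x ∈ₗ xs × f x ≡ y
    ∈-fibre⁻ {xs = xs} {y} = ∈-filter⁻ (λ x → f x ≟ y) {xs = xs}

    |fibre|≡0⇒≢ : ∀ {x xs y} → length (fibre y xs) ≡ 0 → x ∈ₗ xs → f x ≢ y
    |fibre|≡0⇒≢ |fibre|≡0 x∈ fx≡y with subst (1 ≤_) |fibre|≡0 (∈-length (∈-fibre⁺ x∈ fx≡y))
    ... | ()

    ≢⇒|fibre|≡0 : ∀ {xs y} → (∀ {x} → x ∈ₗ xs → f x ≢ y) → length (fibre y xs) ≡ 0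
    ≢⇒|fibre|≡0 {y = y} ≢y = cong length (filter-none (λ x → f x ≟ y) (All.tabulate ≢y))

    |fibre|≤1⇒injectiveOn : ∀ {xs} → (∀ {x} → x ∈ₗ xs → length (fibre (f x) xs) ≤ 1) → InjectiveOn f xs
    |fibre|≤1⇒injectiveOn ≤1 x∈ y∈ fx≡fy = length≤1⇒≡ (≤1 x∈) (∈-fibre⁺ x∈ refl) (∈-fibre⁺ y∈ (sym fx≡fy))

    injectiveOn⇒|fibre|≤1 : ∀ {xs} → Unique xs → InjectiveOn f xs → ∀ y → length (fibre y xs) ≤ 1
    injectiveOn⇒|fibre|≤1 {xs} unique inj y = unique⇒length≤1 (Unique.filter⁺ (λ x → f x ≟ y) unique) same
      where
      same : ∀ {x x′} → x ∈ₗ fibre y xs → x′ ∈ₗ fibre y xs → x ≡ x′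
      same x∈ x′∈ with ∈-fibre⁻ x∈ | ∈-fibre⁻ x′∈
      ... | x∈xs , fx≡y | x′∈xs , fx′≡y = inj x∈xs x′∈xs (trans fx≡y (sym fx′≡y))

    injectiveOn⇒|fibre|≡1 : ∀ {x xs y} → Unique xs → InjectiveOn f xs → x ∈ₗ xs → f x ≡ y →
      length (fibre y xs) ≡ 1
    injectiveOn⇒|fibre|≡1 {y = y} unique inj x∈ fx≡y =
      ≤-antisym (injectiveOn⇒|fibre|≤1 unique inj y) (∈-length (∈-fibre⁺ x∈ fx≡y))

module Digraph {n : ℕ} {E : Set} (src tgt : E → Fin n) where

  data Path (arcs : List E) (u : Fin n) : Fin n → Set where
    ε : Path arcs u u
    step : ∀ e → e ∈ₗ arcs → Path arcs u (src e) → Path arcs u (tgt e)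

  Path-mono : ∀ {arcs arcs′ u v} → arcs ⊆ₗ arcs′ → Path arcs u v → Path arcs′ u v
  Path-mono sub ε = ε
  Path-mono sub (step e e∈ p) = step e (sub e∈) (Path-mono sub p)

  reach-trans : ∀ {arcs u v w} → Reach src tgt arcs u v → Reach src tgt arcs v w → Reach src tgt arcs u w
  reach-trans p here = p
  reach-trans p (fwd e e∈ q) = fwd e e∈ (reach-trans p q)
  reach-trans p (bwd e e∈ q) = bwd e e∈ (reach-trans p q)

  path⇒reach : ∀ {arcs u v} → Path arcs u v → Reach src tgt arcs u v
  path⇒reach ε = here
  path⇒reach (step e e∈ p) = fwd e e∈ (path⇒reach p)

  path⇒reach˘ : ∀ {arcs u v} → Path arcs u v → Reach src tgt arcs v u
  path⇒reach˘ ε = here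
  path⇒reach˘ (step e e∈ p) = reach-trans (bwd e e∈ here) (path⇒reach˘ p)

  -- A backward step along e is harmless: a path to tgt e must end with the only arc entering tgt e, e itself.
  reach⇒path : ∀ {arcs r v} → (∀ {e} → e ∈ₗ arcs → tgt e ≢ r) → InjectiveOn tgt arcs →
    Reach src tgt arcs r v → Path arcs r v
  reach⇒path {arcs} {r} no-in heads-inj = go
    where
    back : ∀ {e w} → e ∈ₗ arcs → Path arcs r w → w ≡ tgt e → Path arcs r (src e)
    back e∈ ε r≡t = ⊥-elim (no-in e∈ (sym r≡t))
    back e∈ (step a a∈ p) t≡t with heads-inj a∈ e∈ t≡t
    ... | refl = p
    go : ∀ {v} → Reach src tgt arcs r v → Path arcs r v
    go here = ε
    go (fwd e e∈ p) = step e e∈ (go p)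
    go (bwd e e∈ p) = back e∈ (go p) refl

  exitArc : ∀ {arcs U u v} → u ∈ U → Path arcs u v → v ∉ U →
    ∃ λ e → e ∈ₗ arcs × src e ∈ U × tgt e ∉ U
  exitArc u∈ ε v∉ = ⊥-elim (v∉ u∈)
  exitArc {U = U} u∈ (step e e∈ p) t∉ with src e ∈? U
  ... | yes s∈ = e , e∈ , s∈ , t∉
  ... | no s∉ = exitArc u∈ p s∉

  lastArc : ∀ {arcs u v} → Path arcs u v → v ≢ u → ∃ λ e → e ∈ₗ arcs × tgt e ≡ v × src e ≢ v
  lastArc ε v≢u = ⊥-elim (v≢u refl)
  lastArc (step e e∈ p) t≢u with src e ≟ tgt e
  ... | no s≢t = e , e∈ , refl , s≢t
  ... | yes s≡t with lastArc p (t≢u ∘ trans (sym s≡t))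
  ... | e′ , e′∈ , t′≡s , s′≢s = e′ , e′∈ , trans t′≡s s≡t , λ s′≡t → s′≢s (trans s′≡t (sym s≡t))

  record RootedArborescence (U : Subset n) (arcs : List E) (r : Fin n) : Set where
    field
      unique : Unique arcs
      endpoints : ∀ {e} → e ∈ₗ arcs → src e ∈ U × tgt e ∈ U
      root∈ : r ∈ U
      root-no-in : ∀ {e} → e ∈ₗ arcs → tgt e ≢ r
      heads-injective : InjectiveOn tgt arcs
      path : ∀ {v} → v ∈ U → Path arcs r v

    in-arc : ∀ {v} → v ∈ U → v ≢ r → ∃ λ e → e ∈ₗ arcs × tgt e ≡ v
    in-arc v∈ v≢r = Product.map₂ (Product.map₂ proj₁) (lastArc (path v∈) v≢r)

    isRoot : IsRoot src tgt U arcs r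
    isRoot = root∈ , ≢⇒|fibre|≡0 tgt root-no-in

  open RootedArborescence

  arborescenceRoot : ∀ {U arcs} → IsArborescence src tgt U arcs → Fin n
  arborescenceRoot (_ , _ , r , _) = r

  fromIsArborescence : ∀ {U arcs} (a : IsArborescence src tgt U arcs) → RootedArborescence U arcs (arborescenceRoot a)
  fromIsArborescence {U} {arcs} ((uniq , ends) , connected , r , (r∈ , indeg-r≡0) , indeg≡1) = record
    { unique = uniq
    ; endpoints = ends _
    ; root∈ = r∈
    ; root-no-in = no-in
    ; heads-injective = heads-inj
    ; path = λ v∈ → reach⇒path no-in heads-inj (connected r _ r∈ v∈)
    }
    where
    no-in : ∀ {e} → e ∈ₗ arcs → tgt e ≢ r
    no-in = |fibre|≡0⇒≢ tgt indeg-r≡0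
    indeg≤1 : ∀ {e} → e ∈ₗ arcs → indeg src tgt arcs (tgt e) ≤ 1
    indeg≤1 {e} e∈ with tgt e ≟ r
    ... | yes t≡r = ⊥-elim (no-in e∈ t≡r)
    ... | no t≢r = ≤-reflexive (indeg≡1 (tgt e) (proj₂ (ends e e∈)) t≢r)
    heads-inj : InjectiveOn tgt arcs
    heads-inj = |fibre|≤1⇒injectiveOn tgt indeg≤1

  toIsArborescence : ∀ {U arcs r} → RootedArborescence U arcs r → IsArborescence src tgt U arcs
  toIsArborescence {U} {arcs} {r} a =
    (unique a , λ _ → endpoints a) , connected , r , isRoot a , indeg≡1
    where
    connected : Connected src tgt U arcs
    connected u v u∈ v∈ = reach-trans (path⇒reach˘ (path a u∈)) (path⇒reach (path a v∈))
    indeg≡1 : ∀ v → v ∈ U → v ≢ r → indeg src tgt arcs v ≡ 1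
    indeg≡1 v v∈ v≢r with in-arc a v∈ v≢r
    ... | e , e∈ , t≡v = injectiveOn⇒|fibre|≡1 tgt (unique a) (heads-injective a) e∈ t≡v

  graft : ∀ {U arcs r e} → RootedArborescence U arcs r → src e ∈ U → tgt e ∉ U →
    RootedArborescence (U ∪ ⁅ tgt e ⁆) (e ∷ arcs) r
  graft {U} {arcs} {r} {e} a s∈ t∉ = record
    { unique = unique-∷ (unique a) fresh
    ; endpoints = λ { (here refl) → p⊆p∪q _ s∈ , q⊆p∪q U _ (x∈⁅x⁆ _)
                    ; (there e′∈) → Product.map (p⊆p∪q _) (p⊆p∪q _) (endpoints a e′∈) }
    ; root∈ = p⊆p∪q _ (root∈ a)
    ; root-no-in = λ { (here refl) t≡r → t∉ (subst (_∈ U) (sym t≡r) (root∈ a))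
                     ; (there e′∈) → root-no-in a e′∈ }
    ; heads-injective = injectiveOn-∷ (heads-injective a) fresh
    ; path = path′
    }
    where
    fresh : ∀ {e′} → e′ ∈ₗ arcs → tgt e′ ≢ tgt e
    fresh e′∈ t′≡t = t∉ (subst (_∈ U) t′≡t (proj₂ (endpoints a e′∈)))
    path′ : ∀ {v} → v ∈ U ∪ ⁅ tgt e ⁆ → Path (e ∷ arcs) r v
    path′ {v} v∈ with x∈p∪q⁻ U _ v∈
    ... | inj₁ v∈U = Path-mono there (path a v∈U)
    ... | inj₂ v∈⁅t⁆ with x∈⁅y⁆⇒x≡y _ v∈⁅t⁆
    ... | refl = step e (here refl) (Path-mono there (path a s∈))

  dropInArcs : Fin n → List E → List E
  dropInArcs u = filter (λ e → ¬? (tgt e ≟ u))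

  -- Covers both a new vertex src e ∉ U and src e ∈ U, whose old in-arc is then dropped.
  reroot : ∀ {U arcs r e} → RootedArborescence U arcs r → tgt e ≡ r → src e ≢ r →
    RootedArborescence (U ∪ ⁅ src e ⁆) (e ∷ dropInArcs (src e) arcs) (src e)
  reroot {U} {arcs} {r} {e} a t≡r s≢r = record
    { unique = unique-∷ (Unique.filter⁺ P? (unique a)) fresh
    ; endpoints = λ { (here refl) → q⊆p∪q U _ (x∈⁅x⁆ _) , p⊆p∪q _ (subst (_∈ U) (sym t≡r) (root∈ a))
                    ; (there e′∈) → Product.map (p⊆p∪q _) (p⊆p∪q _) (endpoints a (kept⊆ e′∈)) }
    ; root∈ = q⊆p∪q U _ (x∈⁅x⁆ _)
    ; root-no-in = λ { (here refl) t≡s → s≢r (trans (sym t≡s) t≡r)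
                     ; (there e′∈) → proj₂ (∈-filter⁻ P? {xs = arcs} e′∈) }
    ; heads-injective = injectiveOn-∷ (injectiveOn-⊆ kept⊆ (heads-injective a)) fresh
    ; path = path′
    }
    where
    P? = λ e′ → ¬? (tgt e′ ≟ src e)
    kept⊆ : dropInArcs (src e) arcs ⊆ₗ arcs
    kept⊆ = filter-⊆ P? arcs
    fresh : ∀ {e′} → e′ ∈ₗ dropInArcs (src e) arcs → tgt e′ ≢ tgt e
    fresh e′∈ t′≡t = root-no-in a (kept⊆ e′∈) (trans t′≡t t≡r)
    lift : ∀ {v} → Path arcs r v → Path (e ∷ dropInArcs (src e) arcs) (src e) v
    lift ε = subst (Path _ (src e)) t≡r (step e (here refl) ε)
    lift (step e′ e′∈ p) with tgt e′ ≟ src e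
    ... | yes t′≡s = subst (Path _ (src e)) (sym t′≡s) ε
    ... | no t′≢s = step e′ (there (∈-filter⁺ P? e′∈ t′≢s)) (lift p)
    path′ : ∀ {v} → v ∈ U ∪ ⁅ src e ⁆ → Path (e ∷ dropInArcs (src e) arcs) (src e) v
    path′ v∈ with x∈p∪q⁻ U _ v∈
    ... | inj₁ v∈U = lift (path a v∈U)
    ... | inj₂ v∈⁅s⁆ with x∈⁅y⁆⇒x≡y _ v∈⁅s⁆
    ... | refl = ε

module RainbowExtension {n : ℕ} (A : Fin (n ∸ 1) → List (Arc n))
  (A-spanning : ∀ i → IsArborescence proj₁ proj₂ ⊤ (A i)) where

  module G = Digraph {n} gsrc gtgt
  module Aᵢ = Digraph {n} {Arc n} proj₁ proj₂
  open G using (RootedArborescence; dropInArcs)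
  open RootedArborescence

  root : Fin (n ∸ 1) → Fin n
  root i = Aᵢ.arborescenceRoot (A-spanning i)

  pathᴬ : ∀ i v → Aᵢ.Path (A i) (root i) v
  pathᴬ i v = Aᵢ.RootedArborescence.path (Aᵢ.fromIsArborescence (A-spanning i)) ∈⊤

  sharedRoot⇒multiRoot : ∀ {i j} → i ≢ j → root i ≡ root j → MultiRoot A ⊤ (root j)
  sharedRoot⇒multiRoot {i} {j} i≢j ρᵢ≡ρⱼ =
    i , j , i≢j , subst (IsRoot proj₁ proj₂ ⊤ (A i)) ρᵢ≡ρⱼ (isRootᴬ i) , isRootᴬ j
    where
    isRootᴬ : ∀ k → IsRoot proj₁ proj₂ ⊤ (A k) (root k)
    isRootᴬ k = Aᵢ.RootedArborescence.isRoot (Aᵢ.fromIsArborescence (A-spanning k))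

  MultiRoots⊆ : Subset n → Set
  MultiRoots⊆ T = ∀ v → MultiRoot A ⊤ v → v ∈ T

  Uses : List (GArc n) → Fin (n ∸ 1) → Set
  Uses B i = Any (λ e → proj₁ e ≡ i) B

  Unused : List (GArc n) → Fin (n ∸ 1) → Set
  Unused B i = ¬ Uses B i

  uses? : ∀ B i → Dec (Uses B i)
  uses? B i = Any.any? (λ e → proj₁ e ≟ i) B

  IsRainbowSubgraph : List (GArc n) → Set
  IsRainbowSubgraph B = InG A B × InjectiveOn proj₁ B

  RootedRainbow : Subset n → List (GArc n) → Fin n → Set
  RootedRainbow T B r = RootedArborescence T B r × IsRainbowSubgraph B

  addArc : ∀ {B B′ e} → IsRainbowSubgraph B → B′ ⊆ₗ B → proj₂ e ∈ₗ A (proj₁ e) → Unused B (proj₁ e) →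
    IsRainbowSubgraph (e ∷ B′)
  addArc {e = e} (inG , rainbow) B′⊆B e∈A fresh = inG′ , injectiveOn-∷ (injectiveOn-⊆ B′⊆B rainbow) fresh′
    where
    fresh′ : ∀ {e′} → e′ ∈ₗ _ → proj₁ e′ ≢ proj₁ e
    fresh′ e′∈ = fresh ∘ lose (B′⊆B e′∈)
    inG′ : InG A (e ∷ _)
    inG′ _ (here refl) = e∈A
    inG′ e′ (there e′∈) = inG e′ (B′⊆B e′∈)

  fromRainbowArborescence : ∀ {T B} → RainbowArborescence A T B → ∃ (RootedRainbow T B)
  fromRainbowArborescence (inG , rainbow , a) =
    G.arborescenceRoot a , G.fromIsArborescence a ,
    inG , |fibre|≤1⇒injectiveOn proj₁ (λ {e} _ → rainbow (proj₁ e))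

  toRainbowArborescence : ∀ {T B r} → RootedRainbow T B r → RainbowArborescence A T B
  toRainbowArborescence (a , inG , rainbow) =
    inG , injectiveOn⇒|fibre|≤1 proj₁ (unique a) rainbow , G.toIsArborescence a

  -- Colour j ↦ head of its arc if used, root of A_j if not: injective, and it misses r and w.
  -- As Fin (n ∸ 1) cannot inject into Fin n minus two points, some unused colour has root w.
  unusedRootAt : ∀ {T B r w} → RootedRainbow T B r → MultiRoots⊆ T → (∀ {j} → Unused B j → root j ∉ T) →
    w ∉ T → ∃ λ j → Unused B j × root j ≡ w
  unusedRootAt {T} {B} {r} {w} (a , _) multiRoots∈ unused∉ w∉
    with Fin.any? (λ j → ¬? (uses? B j) ×-dec (root j ≟ w))
  ... | yes found = found
  ... | no none = ⊥-elim (2+m∸1≰m (injective-missing-two label-inj r≢w (label≢r ∘ d) (label≢w ∘ d)))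
    where
    2+m∸1≰m : ∀ {m} → ¬ 2 + (m ∸ 1) ≤ m
    2+m∸1≰m {suc _} (s≤s le) = 1+n≰n le
    head∈ : ∀ {j} (u : Uses B j) → gtgt (proj₁ (find u)) ∈ T
    head∈ u = proj₂ (endpoints a (proj₁ (proj₂ (find u))))
    label : ∀ j → Dec (Uses B j) → Fin n
    label j (yes u) = gtgt (proj₁ (find u))
    label j (no _) = root j
    d : ∀ j → Dec (Uses B j)
    d j = uses? B j
    label≡⇒≡ : ∀ {j k} (dj : Dec (Uses B j)) (dk : Dec (Uses B k)) →
      label j dj ≡ label k dk → j ≡ k
    label≡⇒≡ (yes uj) (yes uk) eq with find uj | find uk
    ... | _ , e∈ , e↦j | _ , e′∈ , e′↦k =
      trans (sym e↦j) (trans (cong proj₁ (heads-injective a e∈ e′∈ eq)) e′↦k)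
    label≡⇒≡ (yes uj) (no uk) eq = ⊥-elim (unused∉ uk (subst (_∈ T) eq (head∈ uj)))
    label≡⇒≡ (no uj) (yes uk) eq = ⊥-elim (unused∉ uj (subst (_∈ T) (sym eq) (head∈ uk)))
    label≡⇒≡ {j} {k} (no _) (no uk) eq with j ≟ k
    ... | yes j≡k = j≡k
    ... | no j≢k = ⊥-elim (unused∉ uk (multiRoots∈ _ (sharedRoot⇒multiRoot j≢k eq)))
    label-inj : Injective _≡_ _≡_ (λ j → label j (d j))
    label-inj {j} {k} = label≡⇒≡ (d j) (d k)
    r≢w : r ≢ w
    r≢w r≡w = w∉ (subst (_∈ T) r≡w (root∈ a))
    label≢r : ∀ {j} (dj : Dec (Uses B j)) → label j dj ≢ r
    label≢r (yes u) = root-no-in a (proj₁ (proj₂ (find u)))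
    label≢r (no u) ρ≡r = unused∉ u (subst (_∈ T) (sym ρ≡r) (root∈ a))
    label≢w : ∀ {j} (dj : Dec (Uses B j)) → label j dj ≢ w
    label≢w (yes u) h≡w = w∉ (subst (_∈ T) h≡w (head∈ u))
    label≢w (no u) ρ≡w = none (_ , u , ρ≡w)

  usedRoot∈ : ∀ {T B r c} → RootedRainbow T B r → MultiRoots⊆ T → (∀ {j} → Unused B j → root j ∉ T) →
    Uses B c → root c ∈ T
  usedRoot∈ {T} {c = c} rr multiRoots∈ unused∉ used with root c ∈? T
  ... | yes ρ∈ = ρ∈
  ... | no ρ∉ with unusedRootAt rr multiRoots∈ unused∉ ρ∉
  ... | j , j-unused , ρⱼ≡ρ = multiRoots∈ _ (sharedRoot⇒multiRoot j≢c ρⱼ≡ρ)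
    where
    j≢c : j ≢ c
    j≢c refl = j-unused used

  Growth : Subset n → Set
  Growth T = ∃ λ y → y ∉ T × ∃₂ λ B r → RootedRainbow (T ∪ ⁅ y ⁆) B r

  growAlong : ∀ {T B r j x} → RootedRainbow T B r → Unused B j → root j ∈ T → x ∉ T → Growth T
  growAlong {j = j} {x} (a , rainbow) j-unused ρ∈ x∉ with Aᵢ.exitArc ρ∈ (pathᴬ j x) x∉
  ... | p , p∈ , s∈ , t∉ = proj₂ p , t∉ , _ , _ , G.graft a s∈ t∉ , addArc rainbow id p∈ j-unused

  rerootRainbow : ∀ {T B r i p} → RootedRainbow T B r → p ∈ₗ A i → Unused B i → proj₂ p ≡ r → proj₁ p ≢ r →
    RootedRainbow (T ∪ ⁅ proj₁ p ⁆) ((i , p) ∷ dropInArcs (proj₁ p) B) (proj₁ p)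
  rerootRainbow {B = B} (a , rainbow) p∈ i-unused t≡r s≢r =
    G.reroot a t≡r s≢r , addArc rainbow (filter-⊆ _ B) p∈ i-unused

  rerootFreesColour : ∀ {B e e₀} → IsRainbowSubgraph B → Unused B (proj₁ e) → e₀ ∈ₗ B → gtgt e₀ ≡ gsrc e →
    Unused (e ∷ dropInArcs (gsrc e) B) (proj₁ e₀)
  rerootFreesColour _ e-unused e₀∈ _ (here e↦c) = e-unused (lose e₀∈ (sym e↦c))
  rerootFreesColour {B} {e} (_ , rainbow) _ e₀∈ t₀≡u (there used) with find used
  ... | e′ , e′∈ , e′↦c with ∈-filter⁻ (λ e″ → ¬? (gtgt e″ ≟ gsrc e)) {xs = B} e′∈
  ... | e′∈B , t′≢u = t′≢u (trans (cong gtgt (rainbow e′∈B e₀∈ e′↦c)) t₀≡u)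

  growByRerooting : ∀ {T B r x} → RootedRainbow T B r → MultiRoots⊆ T → (∀ {j} → Unused B j → root j ∉ T) →
    x ∉ T → Growth T
  growByRerooting {T} {_} {r} {x} rr@(a , rainbow) multiRoots∈ unused∉ x∉
    with unusedRootAt rr multiRoots∈ unused∉ x∉
  ... | i , i-unused , ρᵢ≡x
    with Aᵢ.lastArc (pathᴬ i r) (λ r≡ρᵢ → x∉ (subst (_∈ T) (trans r≡ρᵢ ρᵢ≡x) (root∈ a)))
  ... | p , p∈ , t≡r , s≢r with proj₁ p ∈? T
  ... | no u∉ = proj₁ p , u∉ , _ , _ , rerootRainbow rr p∈ i-unused t≡r s≢r
  ... | yes u∈ with in-arc a u∈ s≢r
  ... | e₀ , e₀∈ , t₀≡u =
    growAlong (subst (λ U → RootedRainbow U _ _) (x∈p⇒p∪⁅x⁆≡p u∈) (rerootRainbow rr p∈ i-unused t≡r s≢r))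
              (rerootFreesColour rainbow i-unused e₀∈ t₀≡u)
              (usedRoot∈ rr multiRoots∈ unused∉ (lose e₀∈ refl))
              x∉

  grow : ∀ {T B r x} → RootedRainbow T B r → MultiRoots⊆ T → x ∉ T → Growth T
  grow {T} {B} rr multiRoots∈ x∉ with Fin.any? (λ j → ¬? (uses? B j) ×-dec (root j ∈? T))
  ... | yes (j , j-unused , ρ∈) = growAlong rr j-unused ρ∈ x∉
  ... | no none = growByRerooting rr multiRoots∈ (λ j-unused ρ∈ → none (_ , j-unused , ρ∈)) x∉

  extendToSpanning : ∀ {B r} T → Acc _⊃_ T → RootedRainbow T B r → MultiRoots⊆ T →
    ∃[ B′ ] RainbowArborescence A ⊤ B′
  extendToSpanning T (acc smaller) rr multiRoots∈ with Fin.any? (λ x → ¬? (x ∈? T))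
  ... | yes (x , x∉) with grow rr multiRoots∈ x∉
  ... | y , y∉ , _ , _ , rr′ =
    extendToSpanning _ (smaller (p⊂p∪⁅x⁆ y∉)) rr′ (λ v multi → p⊆p∪q _ (multiRoots∈ v multi))
  extendToSpanning T _ rr _ | no none = _ , toRainbowArborescence (subst (λ U → RootedRainbow U _ _) T≡⊤ rr)
    where
    T≡⊤ : T ≡ ⊤
    T≡⊤ = ⊆-antisym ⊆⊤ (λ {x} _ → decidable-stable (x ∈? T) (λ x∉ → none (x , x∉)))

-- The hypothesis 2 ≤ n is unused: 2 + (n ∸ 1) ≤ n fails for every n, so the counting needs no case split.
lemma3p2 : (n : ℕ) → 2 ≤ n →
    (A : Fin (n ∸ 1) → List (Arc n)) →
    (∀ i → IsArborescence {n} proj₁ proj₂ ⊤ (A i)) →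
    (Ṽ : Subset n) → (B̃ : List (GArc n)) →
    RainbowArborescence A Ṽ B̃ →
    (∀ v → MultiRoot A ⊤ v → v ∈ Ṽ) →
    ∃[ B ] RainbowArborescence A ⊤ B
lemma3p2 n _ A A-spanning Ṽ B̃ B̃-rainbow multiRoots∈Ṽ =
  extendToSpanning Ṽ (⊃-wellFounded Ṽ) (proj₂ (fromRainbowArborescence B̃-rainbow)) multiRoots∈Ṽ
  where
  open RainbowExtension A A-spanning
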